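{- Let $\Gamma$ be an AGW graph without loops and with outdegree at least $2$, and suppose $\Gamma$ has a spanning subgraph $R$ consisting only of disjoint cycles (without trees). Then $\Gamma$ has another spanning subgraph in which the maximal level of a vertex is positive and is attained by exactly one vertex.
   Context: An AGW graph is a finite directed strongly connected graph (multiple edges allowed) in which all vertices have the same outdegree $k$, and the greatest common divisor of the lengths of all its cycles is $1$. A spanning subgraph $S$ of $\Gamma$ is a subgraph containing all vertices of $\Gamma$ and exactly one outgoing edge of every vertex; it consists of disjoint cycles together with trees hanging on them. A tree of $S$ is a maximal subtree of $S$ whose root lies on a cycle of $S$ and which has no common edges with the cycles of $S$. The level of a vertex $\mathbf p$ in $S$ is the length of the path from $\mathbf p$ along edges of its tree to the root of the tree (vertices on cycles of $S$ have level $0$). -}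

module Defs where

open import Data.Nat using (ℕ; zero; suc; _<_; _≤_)
open import Data.Fin using (Fin)
open import Data.List using (List; []; _∷_; length)
open import Data.Product using (Σ; ∃; _×_; _,_)
open import Relation.Binary.PropositionalEquality using (_≡_)
open import Relation.Nullary using (¬_)
open import Data.Nat.Divisibility using (_∣_)

-- A directed graph with vertex set Fin n in which every vertex has
-- outdegree k: the k outgoing edges of p are labelled by Fin k and
-- δ p i is the target of the i-th outgoing edge of p.
-- Parallel edges (δ p i ≡ δ p j, i ≢ j) are allowed.
Graph : ℕ → ℕ → Set
Graph n k = Fin n → Fin k → Fin n

module _ {n k : ℕ} (δ : Graph n k) where

  walk : Fin n → List (Fin k) → Fin n
  walk p []       = p
  walk p (i ∷ w)  = walk (δ p i) w

  StronglyConnected : Set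
  StronglyConnected = ∀ p q → ∃ λ (w : List (Fin k)) → walk p w ≡ q

  HasCycleOfLength : ℕ → Set
  HasCycleOfLength m = Σ (Fin n) λ p → Σ (List (Fin k)) λ w →
    (length w ≡ m) × (1 ≤ m) × (walk p w ≡ p)

  -- the gcd of the lengths of all cycles is 1: every common divisor is 1
  CycleGcdOne : Set
  CycleGcdOne = ∀ d → (∀ m → HasCycleOfLength m → d ∣ m) → d ≡ 1

  NoLoops : Set
  NoLoops = ∀ p i → ¬ (δ p i ≡ p)

  AGW : Set
  AGW = StronglyConnected × CycleGcdOne

  -- a spanning subgraph: choice of one outgoing edge for each vertex
  Spanning : Set
  Spanning = Fin n → Fin k

  succ : Spanning → Fin n → Fin n
  succ σ p = δ p (σ p)

  iter : Spanning → ℕ → Fin n → Fin n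
  iter σ zero    p = p
  iter σ (suc t) p = iter σ t (succ σ p)

  OnCycle : Spanning → Fin n → Set
  OnCycle σ p = ∃ λ m → (1 ≤ m) × (iter σ m p ≡ p)

  -- the level of p in σ equals t: t is the length of the path from p
  -- along the tree to its root (the first vertex lying on a cycle)
  Level : Spanning → Fin n → ℕ → Set
  Level σ p t = OnCycle σ (iter σ t p) × (∀ s → s < t → ¬ OnCycle σ (iter σ s p))

  OnlyCycles : Spanning → Set
  OnlyCycles σ = ∀ p → OnCycle σ p

module Submission where

-- Let R be the given spanning subgraph consisting of cycles and f its successor
-- map; f is a permutation of the vertices.  Two cases.
--
-- If some vertex p has an edge p → q with q ≢ f p, let S be R with
-- the edge of p replaced by p → q.  In S the vertex a = f p has no predecessor,
-- so it lies on no cycle, while q lies on a cycle.  The vertices off the cycles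
-- of S are exactly those of the path a, f a, …, p, which S continues by p → q;
-- so a has level t ≥ 1 (its distance to q) and every other vertex has a
-- smaller level.
--
-- Otherwise every edge of every p leads to f p, so every walk of
-- length m acts as f^m.  By strong connectivity each cycle length is then a
-- period of every vertex, hence a multiple of the minimal period of a fixed
-- vertex; the gcd condition makes this minimal period 1, i.e. a loop.

open import Defs
open import Data.Nat using (ℕ; zero; suc; _+_; _*_; _≤_; _<_; z≤n; s≤s; z<s; _%_; _/_)
open import Data.Nat.Properties
open import Data.Nat.DivMod using (m≡m%n+[m/n]*n; m%n<n)
open import Data.Nat.Divisibility using (_∣_; divides)
open import Data.Fin using (Fin) renaming (zero to fzero; _≟_ to _≟ᶠ_)
open import Data.Fin.Properties using (any?)
open import Data.List using ([]; _∷_; length)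
open import Data.Product using (Σ; ∃; _×_; _,_; proj₁; proj₂)
open import Data.Sum using (_⊎_; inj₁; inj₂)
open import Data.Empty using (⊥; ⊥-elim)
open import Relation.Binary.PropositionalEquality
open import Relation.Binary.Definitions using (tri<; tri≈; tri>)
open import Relation.Nullary using (¬_; Dec; yes; no; ¬?)
open import Relation.Nullary.Decidable using (decidable-stable)

Least : (ℕ → Set) → ℕ → Set
Least P j = P j × (∀ i → i < j → ¬ P i)

least : (P : ℕ → Set) → (∀ i → Dec (P i)) → ∀ N → P N → ∃ (Least P)
least P P? zero p0 = 0 , p0 , λ _ ()
least P P? (suc N) pN with P? 0
... | yes p0 = 0 , p0 , λ _ ()
... | no ¬p0 with least (λ i → P (suc i)) (λ i → P? (suc i)) N pN
...   | j , pj , below = suc j , pj , λ { zero _ → ¬p0 ; (suc i) (s≤s i<j) → below i i<j }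

-- An AGW graph has a vertex: with no vertices there are no cycles, and then
-- 0 would be a common divisor of all cycle lengths.
some-vertex : ∀ {n k} (δ : Graph n k) → CycleGcdOne δ → Fin n
some-vertex {zero}  δ gcd1 = ⊥-elim (0≢1+n (gcd1 0 λ { _ (() , _) }))
some-vertex {suc n} δ _    = fzero

rigid-or-reroutable : ∀ {n k} (δ : Graph n k) (h : Fin n → Fin n) →
  (∀ p i → δ p i ≡ h p) ⊎ ∃ λ p → ∃ λ i → ¬ (δ p i ≡ h p)
rigid-or-reroutable δ h with any? (λ p → any? (λ i → ¬? (δ p i ≟ᶠ h p)))
... | yes (p , i , ne) = inj₂ (p , i , ne)
... | no none = inj₁ λ p i → decidable-stable (δ p i ≟ᶠ h p) (λ ne → none (p , i , ne))

module Iteration {n k : ℕ} (δ : Graph n k) (σ : Spanning δ) where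

  private
    g : Fin n → Fin n
    g = succ δ σ
    I : ℕ → Fin n → Fin n
    I = iter δ σ

  iter-+ : ∀ a b x → I (a + b) x ≡ I b (I a x)
  iter-+ zero    b x = refl
  iter-+ (suc a) b x = iter-+ a b (g x)

  iter-suc : ∀ t x → I (suc t) x ≡ g (I t x)
  iter-suc zero    x = refl
  iter-suc (suc t) x = iter-suc t (g x)

  iter-comm : ∀ a b x → I a (I b x) ≡ I b (I a x)
  iter-comm a b x = begin
    I a (I b x)  ≡⟨ iter-+ b a x ⟨
    I (b + a) x  ≡⟨ cong (λ m → I m x) (+-comm b a) ⟩
    I (a + b) x  ≡⟨ iter-+ a b x ⟩
    I b (I a x)  ∎
    where open ≡-Reasoning

  iter-period : ∀ M {x} → I M x ≡ x → ∀ c → I (c * M) x ≡ x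
  iter-period M e zero = refl
  iter-period M {x} e (suc c) =
    trans (iter-+ M (c * M) x) (trans (cong (I (c * M)) e) (iter-period M e c))

  -- The minimal period divides every period: the remainder of a period by
  -- the minimal one is again a period, and smaller than the minimal one.
  period-divides : ∀ {x l} → Least (λ m → I (suc m) x ≡ x) l →
    ∀ {m} → I m x ≡ x → suc l ∣ m
  period-divides {x} {l} (periodic , minimal) {m} e =
    divides (m / suc l) (trans (m≡m%n+[m/n]*n m (suc l)) (cong (_+ (m / suc l) * suc l) rem≡0))
    where
      open ≡-Reasoning
      r = m % suc l
      qP = m / suc l * suc l
      rem-period : I r x ≡ x
      rem-period = begin
        I r x           ≡⟨ cong (I r) (iter-period (suc l) periodic (m / suc l)) ⟨
        I r (I qP x)    ≡⟨ iter-comm r qP x ⟩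
        I qP (I r x)    ≡⟨ iter-+ r qP x ⟨
        I (r + qP) x    ≡⟨ cong (λ s → I s x) (m≡m%n+[m/n]*n m (suc l)) ⟨
        I m x           ≡⟨ e ⟩
        x               ∎
      no-smaller-period : ∀ s → I s x ≡ x → s < suc l → s ≡ 0
      no-smaller-period zero    _  _         = refl
      no-smaller-period (suc s) es (s≤s s<l) = ⊥-elim (minimal s s<l es)
      rem≡0 : r ≡ 0
      rem≡0 = no-smaller-period r rem-period (m%n<n m (suc l))

  onCycle-iter : ∀ r {x} → OnCycle δ σ x → OnCycle δ σ (I r x)
  onCycle-iter r {x} (M , M≥1 , e) = M , M≥1 , trans (iter-comm M r x) (cong (I r) e)

  level-unique : ∀ {x s s'} → Level δ σ x s → Level δ σ x s' → s ≡ s'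
  level-unique {s = s} {s'} (c , before) (c' , before') with <-cmp s s'
  ... | tri< s<s' _ _ = ⊥-elim (before' s s<s' c)
  ... | tri≈ _ s≡s' _ = s≡s'
  ... | tri> _ _ s'<s = ⊥-elim (before s' s'<s c')

  level-shift : ∀ a d e → Level δ σ a (d + e) → Level δ σ (I d a) e
  level-shift a d e (c , before) =
    subst (OnCycle δ σ) (iter-+ d e a) c ,
    λ s s<e oc → before (d + s) (+-monoʳ-< d s<e) (subst (OnCycle δ σ) (sym (iter-+ d s a)) oc)

module CycleCover {n k : ℕ} (δ : Graph n k) (R : Spanning δ) (cover : OnlyCycles δ R) where

  open Iteration δ R

  -- x and y have the common period N = suc M * suc M', and
  -- iter N x is by definition iter (N - 1) (f x).
  succ-injective : ∀ {x y} → succ δ R x ≡ succ δ R y → x ≡ y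
  succ-injective {x} {y} e with cover x | cover y
  ... | zero , () , _ | _
  ... | suc M , _ , px | suc M' , _ , py =
    trans (sym x-period) (trans (cong (iter δ R (M' + M * suc M')) e) y-period)
    where
      x-period : iter δ R (suc M * suc M') x ≡ x
      x-period = subst (λ N → iter δ R N x ≡ x) (*-comm (suc M') (suc M)) (iter-period (suc M) px (suc M'))
      y-period : iter δ R (suc M * suc M') y ≡ y
      y-period = iter-period (suc M') py (suc M)

  iter-injective : ∀ j {x y} → iter δ R j x ≡ iter δ R j y → x ≡ y
  iter-injective zero    e = e
  iter-injective (suc j) e = succ-injective (iter-injective j e)

module Rigid {n k : ℕ} (δ : Graph n k) (R : Spanning δ)
             (rigid : ∀ p i → δ p i ≡ succ δ R p) where

  open Iteration δ R

  walk-iter : ∀ p w → walk δ p w ≡ iter δ R (length w) p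
  walk-iter p []      = refl
  walk-iter p (i ∷ w) = trans (cong (λ y → walk δ y w) (rigid p i)) (walk-iter (succ δ R p) w)

  cycle-length-period : StronglyConnected δ → ∀ {m} → HasCycleOfLength δ m →
    ∀ p → iter δ R m p ≡ p
  cycle-length-period connected {m} (x , w , len , _ , closed) p with connected x p
  ... | u , reach = begin
    iter δ R m p                  ≡⟨ cong (iter δ R m) x→p ⟨
    iter δ R m (iter δ R j x)     ≡⟨ iter-comm m j x ⟩
    iter δ R j (iter δ R m x)     ≡⟨ cong (iter δ R j) x-periodic ⟩
    iter δ R j x                  ≡⟨ x→p ⟩
    p                             ∎
    where
      open ≡-Reasoning
      j = length u
      x→p : iter δ R j x ≡ p
      x→p = trans (sym (walk-iter x u)) reach
      x-periodic : iter δ R m x ≡ x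
      x-periodic = trans (cong (λ l → iter δ R l x) (sym len)) (trans (sym (walk-iter x w)) closed)

  rigid-has-loop : AGW δ → ∀ p → OnCycle δ R p → δ p (R p) ≡ p
  rigid-has-loop (connected , gcd1) p (zero , () , _)
  rigid-has-loop (connected , gcd1) p (suc M , _ , e)
    with least (λ l → iter δ R (suc l) p ≡ p) (λ l → iter δ R (suc l) p ≟ᶠ p) M e
  ... | l , minimal =
    subst (λ P → iter δ R P p ≡ p) (gcd1 (suc l) divides-all) (proj₁ minimal)
    where
      divides-all : ∀ m → HasCycleOfLength δ m → suc l ∣ m
      divides-all m c = period-divides minimal (cycle-length-period connected c p)

module Reroute {n k : ℕ} (δ : Graph n k) (R : Spanning δ) (cover : OnlyCycles δ R)
               (p : Fin n) (i : Fin k)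
               (q≢fp : ¬ (δ p i ≡ succ δ R p)) where

  open CycleCover δ R cover
  open Iteration using (iter-suc; iter-+; onCycle-iter; level-unique; level-shift)

  f : Fin n → Fin n
  f = succ δ R
  F : ℕ → Fin n → Fin n
  F = iter δ R

  q : Fin n
  q = δ p i

  -- the vertex that loses its predecessor
  a : Fin n
  a = f p

  S : Spanning δ
  S x with x ≟ᶠ p
  ... | yes _ = i
  ... | no _  = R x

  g : Fin n → Fin n
  g = succ δ S
  G : ℕ → Fin n → Fin n
  G = iter δ S

  g-p : g p ≡ q
  g-p with p ≟ᶠ p
  ... | yes _  = refl
  ... | no p≢p = ⊥-elim (p≢p refl)

  g-other : ∀ {x} → ¬ (x ≡ p) → g x ≡ f x
  g-other {x} x≢p with x ≟ᶠ p
  ... | yes x≡p = ⊥-elim (x≢p x≡p)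
  ... | no _    = refl

  -- g agrees with the injective f away from p, so only q can have two preimages.
  g-injective : ∀ {z w} → g z ≡ g w → ¬ (g z ≡ q) → z ≡ w
  g-injective {z} {w} e gz≢q = by-cases (z ≟ᶠ p) (w ≟ᶠ p)
    where
      by-cases : Dec (z ≡ p) → Dec (w ≡ p) → z ≡ w
      by-cases (yes z≡p) _         = ⊥-elim (gz≢q (trans (cong g z≡p) g-p))
      by-cases (no _)    (yes w≡p) = ⊥-elim (gz≢q (trans e (trans (cong g w≡p) g-p)))
      by-cases (no z≢p)  (no w≢p)  =
        succ-injective (trans (sym (g-other z≢p)) (trans e (g-other w≢p)))

  a-no-predecessor : ∀ z → ¬ (g z ≡ a)
  a-no-predecessor z e = by-cases (z ≟ᶠ p)
    where
      by-cases : Dec (z ≡ p) → ⊥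
      by-cases (yes z≡p) = q≢fp (trans (sym g-p) (trans (cong g (sym z≡p)) e))
      by-cases (no z≢p)  = z≢p (succ-injective (trans (sym (g-other z≢p)) e))

  -- a vertex on a cycle is the successor of its cycle predecessor
  a-off-cycle : ¬ OnCycle δ S a
  a-off-cycle (zero , () , _)
  a-off-cycle (suc c , _ , e) = a-no-predecessor (G c a) (trans (sym (iter-suc δ S c a)) e)

  agree : ∀ r x → (∀ r' → r' < r → ¬ (F r' x ≡ p)) → G r x ≡ F r x
  agree zero    x avoid = refl
  agree (suc r) x avoid =
    trans (cong (G r) (g-other (avoid 0 z<s))) (agree r (f x) λ r' r'<r → avoid (suc r') (s≤s r'<r))

  FirstHit : Fin n → ℕ → Set
  FirstHit x = Least (λ j → F j x ≡ p)

  -- An R-cycle avoiding p is also a cycle of S.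
  hits-p-or-on-cycle : ∀ x → ∃ (FirstHit x) ⊎ OnCycle δ S x
  hits-p-or-on-cycle x with cover x
  ... | M , M≥1 , e with anyUpTo? (λ j → F j x ≟ᶠ p) M
  ...   | yes (j , _ , hit) = inj₁ (least _ (λ j → F j x ≟ᶠ p) j hit)
  ...   | no none = inj₂ (M , M≥1 , trans (agree M x λ r' r'<M hit → none (r' , r'<M , hit)) e)

  after-hit : ∀ {x j} → FirstHit x j → G (suc j) x ≡ q
  after-hit {x} {j} (hit , before) =
    trans (iter-suc δ S j x) (trans (cong g (trans (agree j x before) hit)) g-p)

  -- Either q returns to q via p, or its R-cycle avoids p.
  q-on-cycle : OnCycle δ S q
  q-on-cycle with hits-p-or-on-cycle q
  ... | inj₁ (j , hit) = suc j , s≤s z≤n , after-hit hit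
  ... | inj₂ c         = c

  a-hits-p : ∃ (FirstHit a)
  a-hits-p with hits-p-or-on-cycle a
  ... | inj₁ hit = hit
  ... | inj₂ c   = ⊥-elim (a-off-cycle c)

  -- Comparing first hits through injectivity of f: a vertex whose R-path
  -- meets p lies on the R-path from a to p.
  first-hit-compare : ∀ {x j ja} → FirstHit x j → FirstHit a ja →
    ∃ λ d → j + d ≡ ja × x ≡ F d a
  first-hit-compare {x} {j} {ja} (hit , before) (hit-a , _) with j ≤? ja
  ... | yes j≤ja =
    let d , j+d≡ja = m≤n⇒∃[o]m+o≡n j≤ja in
    d , j+d≡ja , iter-injective j (begin
      F j x        ≡⟨ trans hit (sym hit-a) ⟩
      F ja a       ≡⟨ cong (λ m → F m a) (trans (sym j+d≡ja) (+-comm j d)) ⟩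
      F (d + j) a  ≡⟨ iter-+ δ R d j a ⟩
      F j (F d a)  ∎)
    where open ≡-Reasoning
  ... | no j≰ja =
    let u , e = m≤n⇒∃[o]m+o≡n (≰⇒> j≰ja)
        j≡1+u+ja : j ≡ suc u + ja
        j≡1+u+ja = trans (sym e) (cong suc (+-comm ja u))
        reaches-a : F (suc u) x ≡ a
        reaches-a = iter-injective ja (trans (sym (iter-+ δ R (suc u) ja x))
                                      (trans (cong (λ m → F m x) (sym j≡1+u+ja)) (trans hit (sym hit-a))))
    in ⊥-elim (before u (subst (u <_) (sym j≡1+u+ja) (s≤s (m≤m+n u ja)))
                        (succ-injective (trans (sym (iter-suc δ R u x)) reaches-a)))

  off-cycle-on-path : ∀ {x} → ¬ OnCycle δ S x → ∃ λ d → x ≡ G d a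
  off-cycle-on-path {x} off with hits-p-or-on-cycle x | a-hits-p
  ... | inj₂ c         | _ = ⊥-elim (off c)
  ... | inj₁ (j , hit) | ja , hit-a with first-hit-compare hit hit-a
  ...   | d , j+d≡ja , x≡Fda =
    d , trans x≡Fda (sym (agree d a λ r' r'<d → proj₂ hit-a r' (<-≤-trans r'<d d≤ja)))
    where
      d≤ja : d ≤ ja
      d≤ja = subst (d ≤_) j+d≡ja (m≤n+m d j)

  cycle-predecessor : ∀ z → OnCycle δ S (g z) → ¬ (g z ≡ q) → OnCycle δ S z
  cycle-predecessor z (zero , () , _) _
  cycle-predecessor z c@(suc m , _ , e) gz≢q =
    subst (OnCycle δ S) (sym z≡w) (onCycle-iter δ S m c)
    where
      w = G m (g z)
      z≡w : z ≡ w
      z≡w = g-injective (sym (trans (sym (iter-suc δ S m (g z))) e)) gz≢q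

  cycle-backwards : ∀ r z → OnCycle δ S (G r z) → (∀ j → j < r → ¬ (G (suc j) z ≡ q)) →
    OnCycle δ S z
  cycle-backwards zero    z c _     = c
  cycle-backwards (suc r) z c avoid =
    cycle-predecessor z (cycle-backwards r (g z) c λ j j<r → avoid (suc j) (s≤s j<r)) (avoid 0 z<s)

  distance : ∃ (Least (λ s → G s a ≡ q))
  distance = least _ (λ s → G s a ≟ᶠ q) (suc (proj₁ a-hits-p)) (after-hit (proj₂ a-hits-p))

  t : ℕ
  t = proj₁ distance
  reaches-q : G t a ≡ q
  reaches-q = proj₁ (proj₂ distance)

  t≥1 : 1 ≤ t
  t≥1 = n≢0⇒n>0 λ t≡0 → q≢fp (sym (subst (λ s → G s a ≡ q) t≡0 reaches-q))

  -- a reaches the cycle at q after t steps, and no earlier vertex of its path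
  -- lies on a cycle, since tracing back would put a on a cycle.
  level-a : Level δ S a t
  level-a = subst (OnCycle δ S) (sym reaches-q) q-on-cycle ,
    λ r r<t c → a-off-cycle (cycle-backwards r a c λ j j<r →
      proj₂ (proj₂ distance) (suc j) (≤-<-trans j<r r<t))

  beyond-q-on-cycle : ∀ {d} → t ≤ d → OnCycle δ S (G d a)
  beyond-q-on-cycle {d} t≤d =
    let u , t+u≡d = m≤n⇒∃[o]m+o≡n t≤d in
    subst (OnCycle δ S) (trans (sym (iter-+ δ S t u a)) (cong (λ m → G m a) t+u≡d))
      (onCycle-iter δ S u (proj₁ level-a))

  level-on-path : ∀ d e → d + e ≡ t → Level δ S (G d a) e
  level-on-path d e d+e≡t = level-shift δ S a d e (subst (Level δ S a) (sym d+e≡t) level-a)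

  -- Every vertex other than a has level below t: off the cycles, it is a
  -- later vertex of the path from a to q.
  level-below : ∀ x s → Level δ S x s → ¬ (x ≡ a) → s < t
  level-below x zero    _ _ = t≥1
  level-below x (suc s) lev@(_ , before) x≢a with off-cycle-on-path (before 0 z<s)
  ... | d , x≡Gda with t ≤? d
  ...   | yes t≤d = ⊥-elim (before 0 z<s (subst (OnCycle δ S) (sym x≡Gda) (beyond-q-on-cycle t≤d)))
  ...   | no t≰d with d
  ...     | zero  = ⊥-elim (x≢a x≡Gda)
  ...     | suc d' =
    let e , d+e≡t = m≤n⇒∃[o]m+o≡n (<⇒≤ (≰⇒> t≰d))
        lev-x : Level δ S x e
        lev-x = subst (λ y → Level δ S y e) (sym x≡Gda) (level-on-path (suc d') e d+e≡t)
    in subst (_< t) (level-unique δ S lev-x lev) (subst (e <_) d+e≡t (m<n+m e {suc d'} z<s))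

lemma6 : ∀ {n k} (δ : Graph n k) → AGW δ → NoLoops δ → 2 ≤ k →
    Σ (Spanning δ) (λ R → OnlyCycles δ R) →
    Σ (Spanning δ) λ S → Σ (Fin n) λ p → Σ ℕ λ t →
    (1 ≤ t) × Level δ S p t ×
    (∀ q s → Level δ S q s → ¬ (q ≡ p) → s < t)
lemma6 δ agw noLoops _ (R , cover) with rigid-or-reroutable δ (succ δ R)
... | inj₁ rigid =
  let p = some-vertex δ (proj₂ agw)
  in ⊥-elim (noLoops p (R p) (Rigid.rigid-has-loop δ R rigid agw p (cover p)))
... | inj₂ (p , i , q≢fp) = S , a , t , t≥1 , level-a , level-below
  where open Reroute δ R cover p i q≢fp
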